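{- Let $\mathcal A$ be a deterministic streaming algorithm maintaining a signed multiset over a finite set $S$ that is uniquely represented, with associated map $u$ from signed multisets to states. If $P,Q$ are signed multisets with $u(P)=u(Q)$, then for every signed multiset $R$, $u(P+R)=u(Q+R)$.
   Context: A signed multiset over a finite set $S$ is a map $f:S\to\mathbb Z$ ($f(x)$ is the number of occurrences of $x$). Inserting $x$ increases $f(x)$ by one; deleting $x$ decreases $f(x)$ by one, so any sequence of insertions and deletions (in any order) starting from the empty multiset (all values $0$) produces a well-defined signed multiset. The signed multisets form a commutative group $M\cong\mathbb Z^{|S|}$ under pointwise addition $(f+g)(x)=f(x)+g(x)$. A deterministic streaming algorithm maintaining a signed multiset has a fixed initial state and processes insert/delete operations one at a time, each operation deterministically transforming the current state into a new state. Such an algorithm is uniquely represented if its state at any time depends only on the signed multiset produced by the operations so far, and not on the order of the insertions and deletions creating it; i.e., there is a map $u$ from $M$ to states such that after any sequence of updates producing multiset $A$ the state is $u(A)$. -}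

module Defs where

open import Level using (Level; suc; _⊔_)
open import Data.Nat using (ℕ)
open import Data.Fin using (Fin)
open import Data.Integer using (ℤ; _+_; _-_; 0ℤ; 1ℤ)
open import Data.Vec using (Vec; replicate; updateAt; zipWith)
open import Data.List using (List; foldl)
open import Relation.Binary.PropositionalEquality using (_≡_)

-- The finite set S is Fin n.  A signed multiset over S is a map S → ℤ,
-- represented as a vector of length n (so equality of multisets is ≡).
SignedMultiset : ℕ → Set
SignedMultiset n = Vec ℤ n

emptyMS : ∀ {n} → SignedMultiset n
emptyMS = replicate _ 0ℤ

_⊕_ : ∀ {n} → SignedMultiset n → SignedMultiset n → SignedMultiset n
_⊕_ = zipWith _+_

data Op (n : ℕ) : Set where
  ins : Fin n → Op n
  del : Fin n → Op n

applyOp : ∀ {n} → SignedMultiset n → Op n → SignedMultiset n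
applyOp f (ins x) = updateAt f x (λ v → v + 1ℤ)
applyOp f (del x) = updateAt f x (λ v → v - 1ℤ)

multisetOf : ∀ {n} → List (Op n) → SignedMultiset n
multisetOf = foldl applyOp emptyMS

record StreamingAlgorithm {ℓ : Level} (n : ℕ) : Set (suc ℓ) where
  field
    State : Set ℓ
    init  : State
    step  : State → Op n → State

  run : List (Op n) → State
  run = foldl step init

open StreamingAlgorithm public

UniquelyRepresentedBy : ∀ {ℓ n} (A : StreamingAlgorithm {ℓ} n) →
  (SignedMultiset n → State A) → Set ℓ
UniquelyRepresentedBy A u = ∀ ops → run A ops ≡ u (multisetOf ops)

module Submission where

-- Running a list of operations from a multiset X is
-- translation: it yields X ⊕ multisetOf ops (the update v ↦ v ± 1 commutes
-- with adding a fixed vector).  Every signed multiset R is multisetOf ys for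
-- some list ys (insert or delete each coordinate the right number of times).
-- Unique representation then makes u equivariant: for every multiset X and
-- operation o, u (applyOp X o) ≡ step (u X) o, because X is reachable by
-- some list xs and both sides are the state after running xs followed by o.
-- Hence, with R = multisetOf ys,
--   u (P ⊕ R) ≡ u (ys applied to P) ≡ (ys run from u P)
--             ≡ (ys run from u Q) ≡ u (ys applied to Q) ≡ u (Q ⊕ R).

open import Defs
open import Level using (Level)
open import Data.Nat using (ℕ; zero; suc)
open import Data.Fin using (Fin) renaming (zero to fzero; suc to fsuc)
open import Data.Integer using (ℤ; +_; -[1+_]; 0ℤ; 1ℤ; -1ℤ) renaming (_+_ to _+ℤ_)
open import Data.Integer.Properties using (+-assoc; +-identityʳ)
open import Data.Vec using ([]; _∷_; updateAt)
open import Data.List using (List; []; _∷_; foldl; map; _++_; _∷ʳ_) renaming (replicate to repeat)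
open import Data.List.Properties using (foldl-++; foldl-∷ʳ)
open import Data.Product using (∃; _,_)
open import Relation.Binary.PropositionalEquality
open ≡-Reasoning

applyOps : ∀ {n} → SignedMultiset n → List (Op n) → SignedMultiset n
applyOps = foldl applyOp

updateAt-⊕ : ∀ {n} (P X : SignedMultiset n) (i : Fin n) (c : ℤ) →
  updateAt (P ⊕ X) i (_+ℤ c) ≡ P ⊕ updateAt X i (_+ℤ c)
updateAt-⊕ (p ∷ P) (x ∷ X) fzero    c = cong (_∷ P ⊕ X) (+-assoc p x c)
updateAt-⊕ (p ∷ P) (x ∷ X) (fsuc i) c = cong (p +ℤ x ∷_) (updateAt-⊕ P X i c)

applyOp-⊕ : ∀ {n} (P X : SignedMultiset n) (o : Op n) →
  applyOp (P ⊕ X) o ≡ P ⊕ applyOp X o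
applyOp-⊕ P X (ins i) = updateAt-⊕ P X i 1ℤ
applyOp-⊕ P X (del i) = updateAt-⊕ P X i -1ℤ

applyOps-⊕ : ∀ {n} (P X : SignedMultiset n) (ops : List (Op n)) →
  applyOps (P ⊕ X) ops ≡ P ⊕ applyOps X ops
applyOps-⊕ P X []        = refl
applyOps-⊕ P X (o ∷ ops) = begin
  applyOps (applyOp (P ⊕ X) o) ops  ≡⟨ cong (λ Y → applyOps Y ops) (applyOp-⊕ P X o) ⟩
  applyOps (P ⊕ applyOp X o) ops    ≡⟨ applyOps-⊕ P (applyOp X o) ops ⟩
  P ⊕ applyOps (applyOp X o) ops    ∎

⊕-identityʳ : ∀ {n} (P : SignedMultiset n) → P ⊕ emptyMS ≡ P
⊕-identityʳ []      = refl
⊕-identityʳ (p ∷ P) = cong₂ _∷_ (+-identityʳ p) (⊕-identityʳ P)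

applyOps-translates : ∀ {n} (P : SignedMultiset n) (ops : List (Op n)) →
  applyOps P ops ≡ P ⊕ multisetOf ops
applyOps-translates P ops = begin
  applyOps P ops              ≡⟨ cong (λ Y → applyOps Y ops) (sym (⊕-identityʳ P)) ⟩
  applyOps (P ⊕ emptyMS) ops  ≡⟨ applyOps-⊕ P emptyMS ops ⟩
  P ⊕ multisetOf ops          ∎

liftOp : ∀ {n} → Op n → Op (suc n)
liftOp (ins i) = ins (fsuc i)
liftOp (del i) = del (fsuc i)

applyOps-lift : ∀ {n} (a : ℤ) (X : SignedMultiset n) (ops : List (Op n)) →
  applyOps (a ∷ X) (map liftOp ops) ≡ a ∷ applyOps X ops
applyOps-lift a X []            = refl
applyOps-lift a X (ins i ∷ ops) = applyOps-lift a _ ops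
applyOps-lift a X (del i ∷ ops) = applyOps-lift a _ ops

applyOps-inserts : ∀ {n} (a : ℤ) (X : SignedMultiset n) (m : ℕ) →
  applyOps (a ∷ X) (repeat m (ins fzero)) ≡ (a +ℤ + m) ∷ X
applyOps-inserts a X zero    = cong (_∷ X) (sym (+-identityʳ a))
applyOps-inserts a X (suc m) =
  trans (applyOps-inserts (a +ℤ 1ℤ) X m) (cong (_∷ X) (+-assoc a 1ℤ (+ m)))

applyOps-deletes : ∀ {n} (a : ℤ) (X : SignedMultiset n) (m : ℕ) →
  applyOps (a ∷ X) (repeat (suc m) (del fzero)) ≡ (a +ℤ -[1+ m ]) ∷ X
applyOps-deletes a X zero    = refl
applyOps-deletes a X (suc m) =
  trans (applyOps-deletes (a +ℤ -1ℤ) X m) (cong (_∷ X) (+-assoc a -1ℤ -[1+ m ]))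

headOps : ∀ {n} → ℤ → List (Op (suc n))
headOps (+ m)    = repeat m (ins fzero)
headOps -[1+ m ] = repeat (suc m) (del fzero)

applyOps-head : ∀ {n} (X : SignedMultiset n) (k : ℤ) →
  applyOps (0ℤ ∷ X) (headOps k) ≡ k ∷ X
applyOps-head X (+ m)    = applyOps-inserts 0ℤ X m
applyOps-head X -[1+ m ] = applyOps-deletes 0ℤ X m

reachable : ∀ {n} (V : SignedMultiset n) → ∃ λ ops → multisetOf ops ≡ V
reachable []      = [] , refl
reachable (k ∷ V) with reachable V
... | ops , ops⇒V = headOps k ++ map liftOp ops , (begin
  multisetOf (headOps k ++ map liftOp ops)
    ≡⟨ foldl-++ applyOp emptyMS (headOps k) (map liftOp ops) ⟩
  applyOps (applyOps emptyMS (headOps k)) (map liftOp ops)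
    ≡⟨ cong (λ Y → applyOps Y (map liftOp ops)) (applyOps-head emptyMS k) ⟩
  applyOps (k ∷ emptyMS) (map liftOp ops)
    ≡⟨ applyOps-lift k emptyMS ops ⟩
  k ∷ multisetOf ops
    ≡⟨ cong (k ∷_) ops⇒V ⟩
  k ∷ V ∎)

module _ {ℓ : Level} {n : ℕ} (A : StreamingAlgorithm {ℓ} n)
         (u : SignedMultiset n → State A) (unique : UniquelyRepresentedBy A u) where

  u-applyOp : ∀ (X : SignedMultiset n) (o : Op n) → u (applyOp X o) ≡ step A (u X) o
  u-applyOp X o with reachable X
  ... | xs , refl = begin
    u (applyOp (multisetOf xs) o)  ≡⟨ cong u (sym (foldl-∷ʳ applyOp emptyMS o xs)) ⟩
    u (multisetOf (xs ∷ʳ o))       ≡⟨ sym (unique (xs ∷ʳ o)) ⟩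
    run A (xs ∷ʳ o)                ≡⟨ foldl-∷ʳ (step A) (init A) o xs ⟩
    step A (run A xs) o            ≡⟨ cong (λ s → step A s o) (unique xs) ⟩
    step A (u (multisetOf xs)) o   ∎

  u-applyOps : ∀ (X : SignedMultiset n) (ops : List (Op n)) →
    u (applyOps X ops) ≡ foldl (step A) (u X) ops
  u-applyOps X []        = refl
  u-applyOps X (o ∷ ops) =
    trans (u-applyOps (applyOp X o) ops) (cong (λ s → foldl (step A) s ops) (u-applyOp X o))

  u-⊕ : ∀ (X : SignedMultiset n) (ops : List (Op n)) →
    u (X ⊕ multisetOf ops) ≡ foldl (step A) (u X) ops
  u-⊕ X ops = trans (cong u (sym (applyOps-translates X ops))) (u-applyOps X ops)

lemma1 : ∀ {ℓ : Level} {n : ℕ} (A : StreamingAlgorithm {ℓ} n)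
    (u : SignedMultiset n → State A) → UniquelyRepresentedBy A u →
    ∀ (P Q : SignedMultiset n) → u P ≡ u Q →
    ∀ (R : SignedMultiset n) → u (P ⊕ R) ≡ u (Q ⊕ R)
lemma1 A u unique P Q uP≡uQ R with reachable R
... | ys , refl = begin
  u (P ⊕ multisetOf ys)          ≡⟨ u-⊕ A u unique P ys ⟩
  foldl (step A) (u P) ys        ≡⟨ cong (λ s → foldl (step A) s ys) uP≡uQ ⟩
  foldl (step A) (u Q) ys        ≡⟨ sym (u-⊕ A u unique Q ys) ⟩
  u (Q ⊕ multisetOf ys)          ∎
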